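{- Let $Abs$ and $Ref$ be well-formed fair event systems, with disjoint tuples of state variables $var_{abs}$ and $var_{ref}$, and suppose $Ref$ is a refinement of $Abs$ with respect to the gluing invariant $J$ (all terms as defined in the context). Let $\sigma = s_0 s_1 \ldots$ be a run of $Ref$. Then there is a run $\tau = t_0 t_1 \ldots$ of $Abs$ such that, for every $i \in \mathbb{N}$, $J$ holds at the joint valuation of $var_{abs}$ and $var_{ref}$ given by $t_i$ and $s_i$.
   Context: A fair event system consists of: constant parameters constrained by a first-order constant assumption $Hyp$; a tuple $var$ of state variables; an initial condition $Init(var)$ (a state predicate); an invariant $Inv(var)$ (a state predicate); and a list of events. Each event $e$ with parameter list $x$ is given by a before-after predicate $BA_e(x,var,var')$ (a first-order formula over constants, $x$, unprimed variables = values before the transition, primed variables $var'$ = values after) and a fairness condition $fair_e(x,var)$ (a state predicate). The feasibility condition is $\mathbf{fis}\, e(x) := \exists var' : BA_e(x,var,var')$. The system is well-formed if $Hyp \models Init \Rightarrow Inv$; for every event $e$, $Hyp \models Inv(var) \land BA_e(x,var,var') \Rightarrow Inv(var')$; and for every event $e$, $Hyp \models Inv \land fair_e(x) \Rightarrow \mathbf{fis}\, e(x)$. A run is an $\omega$-sequence of states (valuations of the variables) $s_0 s_1\ldots$ such that $s_0$ satisfies $Init$; every pair $(s_i,s_{i+1})$ either satisfies $BA_e(x)$ for some event $e$ and some parameter values $x$, or agrees on all variables $var$ (stuttering step); and for every event $e$ and all parameter values $x$ there are infinitely many $i$ such that either $fair_e(x)$ is false at $s_i$ or $(s_i,s_{i+1})$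 satisfies $BA_e(x)$. Temporal formulas: for a run $\sigma$, $\sigma|_n$ denotes the suffix from position $n$; $\sigma|_n\models F$ for a state predicate $F$ means $F$ holds at $s_n$, and for an event formula $e(x)$ means $BA_e(x)$ holds of $(s_n,s_{n+1})$; this extends to Boolean combinations. $\sigma \models F \leadsto G$ iff for all $n$, if $\sigma|_n\models F$ then $\sigma|_m \models G$ for some $m\ge n$. A system satisfies a temporal formula if all its runs do. Refinement: $Ref$ (variables $var_{ref}$) refines $Abs$ (variables $var_{abs}$, disjoint from $var_{ref}$) with respect to a gluing invariant $J$ (a state predicate over $var_{abs}$, $var_{ref}$ and the constants of both systems, assumed to imply $Inv_{abs}$ and $Inv_{ref}$) when the following hold, where $Hyp$ is the conjunction of both constant assumptions. Each abstract event $ea(x)$ is refined by concrete events $er_1(x,y_1),\ldots,er_n(x,y_n)$ (whose parameters include those of $ea$); every other concrete event $en(z)$ is called new. Conditions: $Ref$ is well-formed; (i) $Hyp \models Init_{ref} \Rightarrow \exists var_{abs}: Init_{abs}\land J$; (ii) if $er(x,y)$ refines $ea(x)$ then $Hyp \models J \land BA_{er}(x,y) \Rightarrow \exists var_{abs}': BA_{ea}(x) \land J'$ (where $J'$ is $J$ with all variables primed); (iii) for every new event $en(z)$, $Hyp\models J \land BA_{en}(z) \Rightarrow \exists var_{abs}': var_{abs}'=var_{abs}\land J'$; (iv) for every abstract event $ea(x)$ refined by $er_1,\ldots,er_n$: $Ref \models (\exists var_{abs}: J\land fair_{ea}(x)) \leadsto ea_1(x)\lor\cdots\lor ea_n(x)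 \lor \lnot\exists var_{abs}: J\land fair_{ea}(x)$, where $ea_i(x) := \exists y_i: er_i(x,y_i) \land \forall var_{abs},var_{abs}': (J\land J' \Rightarrow BA_{ea}(x))$. -}

module Defs where

open import Data.Nat using (ℕ; suc; _≤_)
open import Data.Product using (Σ; _×_; _,_)
open import Data.Sum using (_⊎_)
open import Data.Maybe using (Maybe; just; nothing)
open import Relation.Nullary using (¬_)
open import Relation.Binary.PropositionalEquality using (_≡_)

-- C is the type of valuations of the constants (of both systems jointly);
-- each system's constant assumption Hyp is a predicate on C.
-- State is the type of valuations of the system's state variables.
record EventSystem (C : Set) : Set₁ where
  field
    Hyp   : C → Set
    State : Set
    Init  : C → State → Set
    Inv   : C → State → Set
    Event : Set
    Param : Event → Set
    BA    : (c : C) (e : Event) → Param e → State → State → Set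
    fair  : (c : C) (e : Event) → Param e → State → Set

module _ {C : Set} (S : EventSystem C) where
  open EventSystem S

  fis : (c : C) (e : Event) → Param e → State → Set
  fis c e x s = Σ State λ s' → BA c e x s s'

  -- well-formedness (each "Hyp ⊨ φ" is "for every constant valuation satisfying Hyp")
  WellFormed : Set
  WellFormed =
      (∀ c → Hyp c → ∀ s → Init c s → Inv c s)
    × (∀ c → Hyp c → ∀ e x s s' → Inv c s → BA c e x s s' → Inv c s')
    × (∀ c → Hyp c → ∀ e x s → Inv c s → fair c e x s → fis c e x s)

  record IsRun (c : C) (σ : ℕ → State) : Set where
    field
      init     : Init c (σ 0)
      step     : ∀ i → (Σ Event λ e → Σ (Param e) λ x → BA c e x (σ i) (σ (suc i)))
                        ⊎ (σ i ≡ σ (suc i))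
      fairness : ∀ e (x : Param e) (n : ℕ) →
                   Σ ℕ λ i → n ≤ i × ((¬ fair c e x (σ i)) ⊎ BA c e x (σ i) (σ (suc i)))

-- F ↝ G along a run, with F, G given as predicates on positions n (i.e. on σ|_n)
Leadsto : (ℕ → Set) → (ℕ → Set) → Set
Leadsto F G = ∀ n → F n → Σ ℕ λ m → n ≤ m × G m

record Refinement {C : Set} (Abs Ref : EventSystem C)
                  (J : C → EventSystem.State Abs → EventSystem.State Ref → Set) : Set₁ where
  module A = EventSystem Abs
  module R = EventSystem Ref
  Hyp : C → Set
  Hyp c = A.Hyp c × R.Hyp c
  FairJ : C → (ea : A.Event) → A.Param ea → R.State → Set
  FairJ c ea x r = Σ A.State λ a → J c a r × A.fair c ea x a
  field
    J⇒Inv : ∀ c → Hyp c → ∀ a r → J c a r → A.Inv c a × R.Inv c r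
    -- role of each concrete event: either it refines an abstract event ea, with the
    -- parameters of ea obtained from its own by a projection, or it is new (nothing)
    role : (er : R.Event) → Maybe (Σ A.Event λ ea → R.Param er → A.Param ea)
    wf : WellFormed Ref
    -- (i)
    init-ref : ∀ c → Hyp c → ∀ r → R.Init c r → Σ A.State λ a → A.Init c a × J c a r
    -- (ii)
    step-ref : ∀ c → Hyp c → ∀ er ea (π : R.Param er → A.Param ea) → role er ≡ just (ea , π) →
               ∀ y a r r' → J c a r → R.BA c er y r r' →
               Σ A.State λ a' → A.BA c ea (π y) a a' × J c a' r'
    -- (iii)
    step-new : ∀ c → Hyp c → ∀ er → role er ≡ nothing →
               ∀ z a r r' → J c a r → R.BA c er z r r' →
               Σ A.State λ a' → a' ≡ a × J c a' r'
    -- (iv)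
    fair-ref : ∀ c → Hyp c → ∀ (σ : ℕ → R.State) → IsRun Ref c σ →
               ∀ ea (x : A.Param ea) →
               Leadsto (λ i → FairJ c ea x (σ i))
                       (λ i → (Σ R.Event λ er → Σ (R.Param er → A.Param ea) λ π →
                                 role er ≡ just (ea , π) ×
                                 Σ (R.Param er) λ y → π y ≡ x ×
                                   R.BA c er y (σ i) (σ (suc i)) ×
                                   (∀ a a' → J c a (σ i) → J c a' (σ (suc i)) →
                                      A.BA c ea x a a'))
                              ⊎ (¬ FairJ c ea x (σ i)))

module Submission where

open import Defs
open import Level using (0ℓ)
open import Axiom.ExcludedMiddle using (ExcludedMiddle)
open import Data.Nat using (ℕ; zero; suc; _≤_)
open import Data.Nat.Properties using (≤-refl)
open import Data.Product using (Σ; _×_; _,_; proj₁; proj₂)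
open import Data.Sum using (_⊎_; inj₁; inj₂)
open import Data.Maybe using (just; nothing)
open import Relation.Nullary using (¬_; yes; no)
open import Relation.Binary.PropositionalEquality using (_≡_; refl; sym; subst)

-- The abstract trace is built state by state: (i) glues an initial abstract state to s₀, and
-- (ii)/(iii) extend a glued pair along each concrete step (a refined event becomes its abstract
-- event, a new event or a stuttering step becomes a stuttering step). For fairness, if fair_ea(x)
-- holds at tₙ then, tₙ being glued to sₙ, the premise of (iv) holds at n; (iv) then yields an
-- m ≥ n at which either fair_ea(x) fails at every state glued to sₘ, in particular at tₘ, or
-- every pair glued to (sₘ, sₘ₊₁), in particular (tₘ, tₘ₊₁), is an ea(x)-step. Excluded middle
-- decides whether fair_ea(x) holds at tₙ.

dependent-choice : {A : Set} (P : ℕ → A → Set) (R : A → A → Set) (a₀ : A) → P 0 a₀ →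
                   (∀ i a → P i a → Σ A λ a' → R a a' × P (suc i) a') →
                   Σ (ℕ → A) λ τ → τ 0 ≡ a₀ × (∀ i → P i (τ i)) × (∀ i → R (τ i) (τ (suc i)))
dependent-choice {A} P R a₀ p₀ extend = τ , refl , pτ , rτ
  where
    chain : ∀ i → Σ A (P i)
    chain zero    = a₀ , p₀
    chain (suc i) = let (a' , _ , p') = extend i (proj₁ (chain i)) (proj₂ (chain i)) in a' , p'

    τ : ℕ → A
    τ i = proj₁ (chain i)

    pτ : ∀ i → P i (τ i)
    pτ i = proj₂ (chain i)

    rτ : ∀ i → R (τ i) (τ (suc i))
    rτ i = proj₁ (proj₂ (extend i (τ i) (pτ i)))

module _ {C : Set} (S : EventSystem C) where
  open EventSystem S

  Step : C → State → State → Set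
  Step c s s' = (Σ Event λ e → Σ (Param e) λ x → BA c e x s s') ⊎ (s ≡ s')

  Fair : C → (ℕ → State) → Set
  Fair c τ = ∀ e (x : Param e) (n : ℕ) →
             Σ ℕ λ i → n ≤ i × ((¬ fair c e x (τ i)) ⊎ BA c e x (τ i) (τ (suc i)))

module _ {C : Set} {Abs Ref : EventSystem C}
         {J : C → EventSystem.State Abs → EventSystem.State Ref → Set}
         (RF : Refinement Abs Ref J) {c : C} (hyp : Refinement.Hyp RF c) where
  open Refinement RF

  simulate-step : ∀ {a r r'} → J c a r → Step Ref c r r' →
                  Σ A.State λ a' → Step Abs c a a' × J c a' r'
  simulate-step {a} j (inj₂ refl) = a , inj₂ refl , j
  simulate-step {a} {r} {r'} j (inj₁ (er , y , ba)) with role er in rl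
  ... | just (ea , π) =
    let (a' , ba' , j') = step-ref c hyp er ea π rl y a r r' j ba in a' , inj₁ (ea , π y , ba') , j'
  ... | nothing =
    let (a' , a'≡a , j') = step-new c hyp er rl y a r r' j ba in a' , inj₂ (sym a'≡a) , j'

  glued-fair : ExcludedMiddle 0ℓ → ∀ {σ} → IsRun Ref c σ →
               (τ : ℕ → A.State) → (∀ i → J c (τ i) (σ i)) → Fair Abs c τ
  glued-fair em {σ} run τ glued ea x n with em {A.fair c ea x (τ n)}
  ... | no ¬fair = n , ≤-refl , inj₁ ¬fair
  ... | yes fairₙ with fair-ref c hyp σ run ea x n (τ n , glued n , fairₙ)
  ... | m , n≤m , inj₁ (_ , _ , _ , _ , _ , _ , glued⇒BA) =
        m , n≤m , inj₂ (glued⇒BA (τ m) (τ (suc m)) (glued m) (glued (suc m)))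
  ... | m , n≤m , inj₂ ¬fairJ = m , n≤m , inj₁ (λ fairₘ → ¬fairJ (τ m , glued m , fairₘ))

theorem1 : ExcludedMiddle 0ℓ →
    {C : Set} (Abs Ref : EventSystem C)
    (J : C → EventSystem.State Abs → EventSystem.State Ref → Set) →
    WellFormed Abs → WellFormed Ref → Refinement Abs Ref J →
    ∀ (c : C) → EventSystem.Hyp Abs c → EventSystem.Hyp Ref c →
    ∀ (σ : ℕ → EventSystem.State Ref) → IsRun Ref c σ →
    Σ (ℕ → EventSystem.State Abs) λ τ → IsRun Abs c τ × (∀ i → J c (τ i) (σ i))
theorem1 em Abs Ref J _ _ RF c hA hR σ run =
  let (a₀ , initₐ , glued₀) = Refinement.init-ref RF c hyp (σ 0) init
      (τ , τ₀≡a₀ , glued , steps) =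
        dependent-choice (λ i a → J c a (σ i)) (Step Abs c) a₀ glued₀
                         (λ i a j → simulate-step RF hyp j (step i))
  in τ , record { init     = subst (EventSystem.Init Abs c) (sym τ₀≡a₀) initₐ
                ; step     = steps
                ; fairness = glued-fair RF hyp em run τ glued } , glued
  where
    open IsRun run using (init; step)

    hyp : Refinement.Hyp RF c
    hyp = hA , hR
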